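{- Let $t\ge 3$, $s>0$, $d>0$ and $m>0$ be integers with $\binom{m}{t-1}\ge d$. Define $$k:=m\left\lceil\frac{sd(t-1)}{m}\right\rceil-sd(t-1).$$ Then the degree sequence consisting of $s$ degrees equal to $d$, $k$ degrees equal to $\left\lfloor\frac{sd(t-1)}{m}\right\rfloor$, and $m-k$ degrees equal to $\left\lceil\frac{sd(t-1)}{m}\right\rceil$ has a simple $t$-uniform hypergraph realization $H$ such that every edge of $H$ contains exactly one vertex whose prescribed degree is $d$ (i.e., exactly one of the $s$ vertices of the first group).
   Context: A simple $t$-uniform hypergraph has distinct hyperedges each consisting of exactly $t$ vertices. A realization of a degree sequence is a hypergraph on labelled vertices, one per entry, in which each vertex's degree (number of hyperedges containing it) equals its prescribed entry. -}

module Defs where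

open import Data.Nat using (ℕ; _+_; _*_; _∸_; _/_; _<_; suc)
open import Data.Fin using (Fin; toℕ; _↑ˡ_; _↑ʳ_)
open import Data.Fin.Subset using (Subset; ∣_∣; _∈_)
open import Data.Fin.Subset.Properties using (_∈?_)
open import Data.List using (List; length; filter)
open import Data.List.Relation.Unary.All using (All)
open import Data.List.Relation.Unary.Unique.Propositional using (Unique)
open import Data.Product using (_×_; ∃; ∃-syntax; _,_)
open import Data.Bool using (if_then_else_)
open import Data.Sum using (inj₁; inj₂)
open import Data.Nat using (NonZero; _<ᵇ_)
open import Data.Vec using (take)
open import Relation.Nullary.Decidable using (⌊_⌋)
open import Relation.Binary.PropositionalEquality using (_≡_)

Hypergraph : ℕ → Set
Hypergraph n = List (Subset n)

SimpleUniform : ∀ {n} → ℕ → Hypergraph n → Set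
SimpleUniform t H = Unique H × All (λ e → ∣ e ∣ ≡ t) H

degree : ∀ {n} → Hypergraph n → Fin n → ℕ
degree H v = length (filter (v ∈?_) H)

Realizes : ∀ {n} → Hypergraph n → (Fin n → ℕ) → Set
Realizes H δ = ∀ v → degree H v ≡ δ v

ceilDiv : ℕ → (m : ℕ) → .{{_ : NonZero m}} → ℕ
ceilDiv x m = (x + (m ∸ 1)) / m

-- number of vertices of degree d in hyperedge e among the first s
-- (vertex set Fin (s + m): first s vertices are the "d" group)
firstGroupCount : ∀ s m → Subset (s + m) → ℕ
firstGroupCount s m e = ∣ take s e ∣

degSeq : (t s d m : ℕ) → .{{_ : NonZero m}} → Fin (s + m) → ℕ
degSeq t s d m v with Data.Fin.splitAt s v
... | inj₁ _ = d
... | inj₂ j = if toℕ j <ᵇ k then x / m else ceilDiv x m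
  where
  x = s * d * (t ∸ 1)
  k = m * ceilDiv x m ∸ x

{-# OPTIONS --safe #-}
-- Number the m non-centre vertices 0, …, m - 1 and read them cyclically starting from
-- k = m⌈x/m⌉ - x, where x = s d (t - 1): the s centres in turn take the next d (t - 1)
-- entries of this cyclic sequence, and each centre is joined to a simple (t - 1)-uniform
-- hypergraph with d edges realising the multiplicities of its own block. Since k + x is a
-- multiple of m, vertex j occurs ⌊x/m⌋ times if j < k and ⌈x/m⌉ times otherwise.
--
-- A cyclic block of length d r on n vertices is realised by d distinct r-sets whenever
-- d ≤ C(n, r), by induction on n: vertex 0 occurs h times with |n h - d r| < n; deleting
-- its occurrences leaves a cyclic block on n - 1 vertices, whose first h (r - 1) entries are
-- realised by the link of 0 and whose remaining (d - h) r entries by the deletion. The bounds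
-- h ≤ C(n-1, r-1) and d - h ≤ C(n-1, r) follow from r C(n, r) = n C(n-1, r-1).
module Submission where

open import Defs
open import Data.Nat.Combinatorics using (_C_; nC1≡n; k>n⇒nCk≡0; nCk+nC[k+1]≡[n+1]C[k+1])
open import Data.Product using (Σ; _×_; _,_; proj₁; proj₂)
open import Data.List.Relation.Unary.All using (All; []; _∷_)
open import Relation.Binary.PropositionalEquality
open import Data.Bool using (true; false; if_then_else_; T)
open import Data.Bool.Properties using (T-≡)
open import Data.Fin using (Fin; zero; suc; toℕ; _↑ˡ_; _↑ʳ_; splitAt)
open import Data.Fin.Properties using (toℕ<n; splitAt⁻¹-↑ˡ; splitAt⁻¹-↑ʳ)
open import Data.Fin.Subset using (Subset; inside; outside; ∣_∣; ⊥)
open import Data.Fin.Subset.Properties using (_∈?_; ∉⊥; ∣⊥∣≡0)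
open import Data.List using (List; []; _∷_; _++_; length; filter; iterate; take; drop; map)
open import Data.List.Membership.Propositional using () renaming (_∈_ to _∈ₗ_)
open import Data.List.Membership.Propositional.Properties using (∈-map⁻)
open import Data.List.Properties
  using (length-map; length-++; length-filter; length-iterate; filter-++; filter-accept; filter-reject;
         take-[]; drop-[]; length-take; length-drop; take++drop≡id)
import Data.List.Relation.Unary.All as All
import Data.List.Relation.Unary.All.Properties as All
open import Data.List.Relation.Unary.AllPairs using ([]; _∷_)
open import Data.List.Relation.Unary.Unique.Propositional using (Unique)
import Data.List.Relation.Unary.Unique.Propositional.Properties as Unique
open import Data.Nat
open import Data.Nat.Properties
open import Data.Nat.DivMod using (m≡m%n+[m/n]*n; m%n<n; m/n*n≤m; m<n⇒m/n≡0; m*n/n≡m; +-distrib-/-∣ʳ)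
open import Data.Nat.Divisibility using (divides)
import Data.Nat.GeneralisedArithmetic as ℕ
open import Data.Nat.Tactic.RingSolver using (solve-∀)
open import Data.Sum using (inj₁; inj₂)
open import Data.Vec using (_∷_) renaming (_++_ to _++ᵥ_)
open import Data.Vec.Properties using (∷-injectiveʳ; ++-injectiveʳ)
open import Function using (_∘_; Equivalence)
open import Level using (0ℓ)
open import Relation.Nullary using (¬_; yes; no; does; contradiction)
open import Relation.Unary using (Pred)

-- Cyclic runs of residues

length-take-+ : ∀ {A : Set} k {l} (xs : List A) → length xs ≡ k + l → length (take k xs) ≡ k
length-take-+ k xs len = trans (length-take k xs) (m≤n⇒m⊓n≡m (subst (k ≤_) (sym len) (m≤m+n k _)))

length-drop-+ : ∀ {A : Set} k {l} (xs : List A) → length xs ≡ k + l → length (drop k xs) ≡ l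
length-drop-+ k {l} xs len = trans (length-drop k xs) (trans (cong (_∸ k) len) (m+n∸m≡n k l))

count : ℕ → List ℕ → ℕ
count j = length ∘ filter (j ≟_)

count-++ : ∀ j xs ys → count j (xs ++ ys) ≡ count j xs + count j ys
count-++ j xs ys = trans (cong length (filter-++ (j ≟_) xs ys)) (length-++ (filter (j ≟_) xs))

count-≤-length : ∀ j xs → count j xs ≤ length xs
count-≤-length j = length-filter (j ≟_)

count-here : ∀ j xs → count j (j ∷ xs) ≡ suc (count j xs)
count-here j xs = cong length (filter-accept (j ≟_) refl)

count-there : ∀ {j x} xs → j ≢ x → count j (x ∷ xs) ≡ count j xs
count-there xs j≢x = cong length (filter-reject (_ ≟_) j≢x)

iterate-+ : ∀ {A : Set} (f : A → A) x m n →
  iterate f x (m + n) ≡ iterate f x m ++ iterate f (ℕ.iterate f x m) n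
iterate-+ f x zero    n = refl
iterate-+ f x (suc m) n = cong (x ∷_) (iterate-+ f (f x) m n)

ℕ-iterate-+ : ∀ {A : Set} (f : A → A) x m n → ℕ.iterate f x (m + n) ≡ ℕ.iterate f (ℕ.iterate f x m) n
ℕ-iterate-+ f x zero    n = refl
ℕ-iterate-+ f x (suc m) n = ℕ-iterate-+ f (f x) m n

take-iterate : ∀ {A : Set} (f : A → A) x m n → take m (iterate f x n) ≡ iterate f x (m ⊓ n)
take-iterate f x zero    n       = refl
take-iterate f x (suc m) zero    = refl
take-iterate f x (suc m) (suc n) = cong (x ∷_) (take-iterate f (f x) m n)

drop-iterate : ∀ {A : Set} (f : A → A) x m n → drop m (iterate f x n) ≡ iterate f (ℕ.iterate f x m) (n ∸ m)
drop-iterate f x zero    n       = refl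
drop-iterate f x (suc m) zero    = refl
drop-iterate f x (suc m) (suc n) = drop-iterate f (f x) m n

interval : ℕ → ℕ → List ℕ
interval = iterate suc

count-interval-below : ∀ {j a} S → j < a → count j (interval a S) ≡ 0
count-interval-below         zero    j<a = refl
count-interval-below {j} {a} (suc S) j<a with j ≟ a
... | yes refl = contradiction j<a (n≮n j)
... | no  j≢a  = trans (count-there _ j≢a) (count-interval-below S (m<n⇒m<1+n j<a))

count-interval-above : ∀ {j a} S → a + S ≤ j → count j (interval a S) ≡ 0
count-interval-above         zero    _   = refl
count-interval-above {j} {a} (suc S) a+S≤j with j ≟ a
... | yes refl = contradiction a+S≤j (<⇒≱ (m<m+n j z<s))
... | no  j≢a  = trans (count-there _ j≢a) (count-interval-above S (≤-trans (≤-reflexive (sym (+-suc a S))) a+S≤j))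

count-interval-inside : ∀ {j a} S → a ≤ j → j < a + S → count j (interval a S) ≡ 1
count-interval-inside {j} {a} zero    a≤j j<a+S = contradiction (≤-trans (≤-reflexive (+-identityʳ a)) a≤j) (<⇒≱ j<a+S)
count-interval-inside {j} {a} (suc S) a≤j j<a+S with j ≟ a
... | yes refl = trans (count-here j _) (cong suc (count-interval-below S (n<1+n j)))
... | no  j≢a  = trans (count-there _ j≢a) (count-interval-inside S (≤∧≢⇒< a≤j (j≢a ∘ sym)) (subst (j <_) (+-suc a S) j<a+S))

next : ℕ → ℕ → ℕ
next N a = if suc a <ᵇ N then suc a else 0

rotation : ℕ → ℕ → ℕ → List ℕ
rotation N = iterate (next N)

shift : ℕ → ℕ → ℕ → ℕ
shift N = ℕ.iterate (next N)

length-rotation : ∀ N a S → length (rotation N a S) ≡ S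
length-rotation N = length-iterate (next N)

next-suc : ∀ {N a} → suc a < N → next N a ≡ suc a
next-suc {N} {a} 1+a<N rewrite Equivalence.to T-≡ (<⇒<ᵇ 1+a<N) = refl

next-wrap : ∀ {N a} → N ≤ suc a → next N a ≡ 0
next-wrap {N} {a} N≤1+a with suc a <ᵇ N in eq
... | true  = contradiction (<ᵇ⇒< (suc a) N (Equivalence.from T-≡ eq)) (≤⇒≯ N≤1+a)
... | false = refl

next-< : ∀ {N a} → a < N → next N a < N
next-< {N} {a} a<N with suc a <? N
... | yes 1+a<N = subst (_< N) (sym (next-suc 1+a<N)) 1+a<N
... | no  1+a≮N = subst (_< N) (sym (next-wrap (≮⇒≥ 1+a≮N))) (≤-trans (s≤s z≤n) a<N)

shift-< : ∀ {N a} S → a < N → shift N a S < N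
shift-< zero    a<N = a<N
shift-< (suc S) a<N = shift-< S (next-< a<N)

rotation-+ : ∀ N a S T → rotation N a (S + T) ≡ rotation N a S ++ rotation N (shift N a S) T
rotation-+ N = iterate-+ (next N)

shift-+ : ∀ N a S T → shift N a (S + T) ≡ shift N (shift N a S) T
shift-+ N = ℕ-iterate-+ (next N)

rotation-interval : ∀ {N a} S → a + S ≤ N → rotation N a S ≡ interval a S
rotation-interval         zero          _     = refl
rotation-interval         (suc zero)    _     = refl
rotation-interval {N} {a} (suc (suc S)) a+S≤N = cong (a ∷_) (begin
  rotation N (next N a) (suc S) ≡⟨ cong (λ b → rotation N b (suc S)) (next-suc (≤-trans 2+a≤a+2+S a+S≤N)) ⟩
  rotation N (suc a) (suc S)    ≡⟨ rotation-interval (suc S) (≤-trans (≤-reflexive (sym (+-suc a (suc S)))) a+S≤N) ⟩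
  interval (suc a) (suc S)      ∎)
  where
  open ≡-Reasoning
  2+a≤a+2+S : 2 + a ≤ a + suc (suc S)
  2+a≤a+2+S = subst (_≤ a + suc (suc S)) (+-comm a 2) (+-monoʳ-≤ a (s≤s (s≤s z≤n)))

shift-suc-interval : ∀ {N a} S → a + S < N → shift N a (suc S) ≡ next N (a + S)
shift-suc-interval {N} {a} zero    _       = cong (next N) (sym (+-identityʳ a))
shift-suc-interval {N} {a} (suc S) a+S<N = begin
  shift N (next N a) (suc S) ≡⟨ cong (λ b → shift N b (suc S)) (next-suc (≤-trans (s≤s (s≤s (m≤m+n a S))) a+1+S<N)) ⟩
  shift N (suc a) (suc S)    ≡⟨ shift-suc-interval S a+1+S<N ⟩
  next N (suc a + S)         ≡⟨ cong (next N) (sym (+-suc a S)) ⟩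
  next N (a + suc S)         ∎
  where
  open ≡-Reasoning
  a+1+S<N : suc a + S < N
  a+1+S<N = subst (_< N) (+-suc a S) a+S<N

shift-interval : ∀ {N a} S → a + S < N → shift N a S ≡ a + S
shift-interval {N} {a} zero    _     = sym (+-identityʳ a)
shift-interval {N} {a} (suc S) a+S<N = begin
  shift N a (suc S) ≡⟨ shift-suc-interval S (<-trans (+-monoʳ-< a (n<1+n S)) a+S<N) ⟩
  next N (a + S)    ≡⟨ next-suc (subst (_< N) (+-suc a S) a+S<N) ⟩
  suc (a + S)       ≡⟨ sym (+-suc a S) ⟩
  a + suc S         ∎
  where open ≡-Reasoning

shift-wrap : ∀ {N a} S → a + suc S ≡ N → shift N a (suc S) ≡ 0
shift-wrap {N} {a} S a+1+S≡N = trans (shift-suc-interval S a+S<N) (next-wrap (≤-reflexive (trans (sym a+1+S≡N) (+-suc a S))))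
  where
  a+S<N : a + S < N
  a+S<N = subst (a + S <_) a+1+S≡N (+-monoʳ-< a (n<1+n S))

shift-to-end : ∀ {N a} → a < N → shift N a (N ∸ a) ≡ 0
shift-to-end {N} {a} a<N with N ∸ a | m+[n∸m]≡n (<⇒≤ a<N)
... | zero  | a+0≡N   = contradiction (trans (sym (+-identityʳ a)) a+0≡N) (<⇒≢ a<N)
... | suc S | a+1+S≡N = shift-wrap S a+1+S≡N

rotation-period : ∀ {N a} → a < N → rotation N a N ≡ interval a (N ∸ a) ++ interval 0 a
rotation-period {N} {a} a<N = begin
  rotation N a N                                             ≡⟨ cong (rotation N a) (sym (m∸n+n≡m (<⇒≤ a<N))) ⟩
  rotation N a (N ∸ a + a)                                   ≡⟨ rotation-+ N a (N ∸ a) a ⟩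
  rotation N a (N ∸ a) ++ rotation N (shift N a (N ∸ a)) a   ≡⟨ cong₂ _++_ (rotation-interval (N ∸ a) (≤-reflexive (m+[n∸m]≡n (<⇒≤ a<N))))
                                                                             (cong (λ b → rotation N b a) (shift-to-end a<N)) ⟩
  interval a (N ∸ a) ++ rotation N 0 a                       ≡⟨ cong (interval a (N ∸ a) ++_) (rotation-interval a (<⇒≤ a<N)) ⟩
  interval a (N ∸ a) ++ interval 0 a                         ∎
  where open ≡-Reasoning

count-rotation-period : ∀ {N a j} → a < N → j < N → count j (rotation N a N) ≡ 1
count-rotation-period {N} {a} {j} a<N j<N
  rewrite rotation-period a<N | count-++ j (interval a (N ∸ a)) (interval 0 a) with j <? a
... | yes j<a = cong₂ _+_ (count-interval-below (N ∸ a) j<a) (count-interval-inside a z≤n j<a)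
... | no  j≮a = cong₂ _+_ (count-interval-inside (N ∸ a) (≮⇒≥ j≮a) (subst (j <_) (sym (m+[n∸m]≡n (<⇒≤ a<N))) j<N))
                          (count-interval-above a (≮⇒≥ j≮a))

shift-period : ∀ {N a} → a < N → shift N a N ≡ a
shift-period {N} {a} a<N = begin
  shift N a N                         ≡⟨ cong (shift N a) (sym (m∸n+n≡m (<⇒≤ a<N))) ⟩
  shift N a (N ∸ a + a)               ≡⟨ shift-+ N a (N ∸ a) a ⟩
  shift N (shift N a (N ∸ a)) a       ≡⟨ cong (λ b → shift N b a) (shift-to-end a<N) ⟩
  shift N 0 a                         ≡⟨ shift-interval a a<N ⟩
  a                                   ∎
  where open ≡-Reasoning

count-rotation-periods : ∀ {N a j} q X → a < N → j < N →
  count j (rotation N a (q * N + X)) ≡ q + count j (rotation N a X)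
count-rotation-periods             zero    X a<N j<N = refl
count-rotation-periods {N} {a} {j} (suc q) X a<N j<N = begin
  count j (rotation N a (N + q * N + X))                                    ≡⟨ cong (count j ∘ rotation N a) (+-assoc N (q * N) X) ⟩
  count j (rotation N a (N + (q * N + X)))                                  ≡⟨ cong (count j) (rotation-+ N a N (q * N + X)) ⟩
  count j (rotation N a N ++ rotation N (shift N a N) (q * N + X))          ≡⟨ count-++ j (rotation N a N) _ ⟩
  count j (rotation N a N) + count j (rotation N (shift N a N) (q * N + X)) ≡⟨ cong₂ _+_ (count-rotation-period a<N j<N)
                                                                                       (cong (λ b → count j (rotation N b (q * N + X))) (shift-period a<N)) ⟩
  1 + count j (rotation N a (q * N + X))                                    ≡⟨ cong suc (count-rotation-periods q X a<N j<N) ⟩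
  suc q + count j (rotation N a X)                                          ∎
  where open ≡-Reasoning

count-rotation-≤1 : ∀ {N a j} S → a < N → j < N → S ≤ N → count j (rotation N a S) ≤ 1
count-rotation-≤1 {N} {a} {j} S a<N j<N S≤N = begin
  count j (rotation N a S)                                                  ≤⟨ m≤m+n _ _ ⟩
  count j (rotation N a S) + count j (rotation N (shift N a S) (N ∸ S))     ≡⟨ count-++ j (rotation N a S) _ ⟨
  count j (rotation N a S ++ rotation N (shift N a S) (N ∸ S))              ≡⟨ cong (count j) (rotation-+ N a S (N ∸ S)) ⟨
  count j (rotation N a (S + (N ∸ S)))                                      ≡⟨ cong (count j ∘ rotation N a) (m+[n∸m]≡n S≤N) ⟩
  count j (rotation N a N)                                                  ≡⟨ count-rotation-period a<N j<N ⟩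
  1                                                                         ∎
  where open ≤-Reasoning

-- c is ⌊S / (n + 1)⌋ or ⌈S / (n + 1)⌉.
NearQuotient : ℕ → ℕ → ℕ → Set
NearQuotient n S c = suc n * c ≤ S + n × S ≤ suc n * c + n

nearQuotient-+ : ∀ n q ρ ε → ε ≤ 1 → ε ≤ ρ → ρ ≤ n → NearQuotient n (q * suc n + ρ) (q + ε)
nearQuotient-+ n q ρ ε ε≤1 ε≤ρ ρ≤n =
    (begin
      suc n * (q + ε)             ≡⟨ split ⟩
      q * suc n + suc n * ε       ≤⟨ +-monoʳ-≤ (q * suc n) (lower ε≤1 ε≤ρ) ⟩
      q * suc n + (ρ + n)         ≡⟨ +-assoc (q * suc n) ρ n ⟨
      q * suc n + ρ + n           ∎)
  , (begin
      q * suc n + ρ               ≤⟨ +-monoʳ-≤ (q * suc n) upper ⟩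
      q * suc n + (suc n * ε + n) ≡⟨ +-assoc (q * suc n) (suc n * ε) n ⟨
      q * suc n + suc n * ε + n   ≡⟨ cong (_+ n) split ⟨
      suc n * (q + ε) + n         ∎)
  where
  open ≤-Reasoning
  split : suc n * (q + ε) ≡ q * suc n + suc n * ε
  split = trans (*-distribˡ-+ (suc n) q ε) (cong (_+ suc n * ε) (*-comm (suc n) q))
  lower : ε ≤ 1 → ε ≤ ρ → suc n * ε ≤ ρ + n
  lower z≤n       _   = ≤-trans (≤-reflexive (*-zeroʳ n)) z≤n
  lower (s≤s z≤n) 1≤ρ = ≤-trans (≤-reflexive (*-identityʳ (suc n))) (+-monoˡ-≤ n 1≤ρ)
  upper : ρ ≤ suc n * ε + n
  upper = ≤-trans ρ≤n (m≤n+m n _)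

count-rotation-nearQuotient : ∀ {n a j} S → a < suc n → j < suc n →
  NearQuotient n S (count j (rotation (suc n) a S))
count-rotation-nearQuotient {n} {a} {j} S a<N j<N =
  subst (λ S → NearQuotient n S (count j (rotation (suc n) a S))) (sym S≡q*N+ρ)
    (subst (NearQuotient n (q * suc n + ρ)) (sym (count-rotation-periods q ρ a<N j<N))
      (nearQuotient-+ n q ρ ε (count-rotation-≤1 ρ a<N j<N (<⇒≤ ρ<N)) ε≤ρ (≤-pred ρ<N)))
  where
  q = S / suc n
  ρ = S % suc n
  ρ<N : ρ < suc n
  ρ<N = m%n<n S (suc n)
  S≡q*N+ρ : S ≡ q * suc n + ρ
  S≡q*N+ρ = trans (m≡m%n+[m/n]*n S (suc n)) (+-comm ρ (q * suc n))
  ε = count j (rotation (suc n) a ρ)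
  ε≤ρ : ε ≤ ρ
  ε≤ρ = subst (ε ≤_) (length-rotation (suc n) a ρ) (count-≤-length j (rotation (suc n) a ρ))

dropZeros : List ℕ → List ℕ
dropZeros []           = []
dropZeros (zero  ∷ xs) = dropZeros xs
dropZeros (suc x ∷ xs) = x ∷ dropZeros xs

count-dropZeros : ∀ j xs → count j (dropZeros xs) ≡ count (suc j) xs
count-dropZeros j []           = refl
count-dropZeros j (zero  ∷ xs) = count-dropZeros j xs
count-dropZeros j (suc x ∷ xs) with j ≟ x
... | yes refl = trans (count-here j _) (trans (cong suc (count-dropZeros j xs)) (sym (count-here (suc j) xs)))
... | no  j≢x  = trans (count-there _ j≢x) (trans (count-dropZeros j xs) (sym (count-there xs (j≢x ∘ suc-injective))))

length-dropZeros : ∀ xs → length (dropZeros xs) + count 0 xs ≡ length xs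
length-dropZeros []           = refl
length-dropZeros (zero  ∷ xs) = trans (+-suc _ _) (cong suc (length-dropZeros xs))
length-dropZeros (suc x ∷ xs) = cong suc (length-dropZeros xs)

pred-next : ∀ N a → pred (next (suc N) (suc a)) ≡ next N a
pred-next N a with suc a <ᵇ N
... | true  = refl
... | false = refl

dropZeros-rotation : ∀ n a S →
  dropZeros (rotation (suc (suc n)) a S) ≡ rotation (suc n) (pred a) (S ∸ count 0 (rotation (suc (suc n)) a S))
dropZeros-rotation n a       zero    = refl
dropZeros-rotation n zero    (suc S) = dropZeros-rotation n 1 S
dropZeros-rotation n (suc a) (suc S) = begin
  a ∷ dropZeros (rotation N (next N (suc a)) S)             ≡⟨ cong (a ∷_) (dropZeros-rotation n (next N (suc a)) S) ⟩
  a ∷ rotation (suc n) (pred (next N (suc a))) (S ∸ c)      ≡⟨ cong (λ b → a ∷ rotation (suc n) b (S ∸ c)) (pred-next (suc n) a) ⟩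
  rotation (suc n) a (suc (S ∸ c))                          ≡⟨ cong (rotation (suc n) a) (+-∸-assoc 1 c≤S) ⟨
  rotation (suc n) a (suc S ∸ c)                            ∎
  where
  open ≡-Reasoning
  N = suc (suc n)
  c = count 0 (rotation N (next N (suc a)) S)
  c≤S : c ≤ S
  c≤S = subst (c ≤_) (length-rotation N _ S) (count-≤-length 0 (rotation N (next N (suc a)) S))

dropZeros-rotation₁ : ∀ S → dropZeros (rotation 1 0 S) ≡ []
dropZeros-rotation₁ zero    = refl
dropZeros-rotation₁ (suc S) = dropZeros-rotation₁ S

-- The constructor [] is needed only for n = 0, where there is no run.
data Cyclic (n : ℕ) : List ℕ → Set where
  []  : Cyclic n []
  run : ∀ {a} → a < n → ∀ S → Cyclic n (rotation n a S)

Cyclic-take : ∀ {n ws} k → Cyclic n ws → Cyclic n (take k ws)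
Cyclic-take {n} k []          = subst (Cyclic n) (sym (take-[] k)) []
Cyclic-take {n} k (run a<n S) = subst (Cyclic n) (sym (take-iterate (next n) _ k S)) (run a<n (k ⊓ S))

Cyclic-drop : ∀ {n ws} k → Cyclic n ws → Cyclic n (drop k ws)
Cyclic-drop {n} k []          = subst (Cyclic n) (sym (drop-[] k)) []
Cyclic-drop {n} k (run a<n S) = subst (Cyclic n) (sym (drop-iterate (next n) _ k S)) (run (shift-< k a<n) (S ∸ k))

Cyclic-dropZeros : ∀ {n ws} → Cyclic (suc n) ws → Cyclic n (dropZeros ws)
Cyclic-dropZeros             []                    = []
Cyclic-dropZeros {zero}      (run (s≤s z≤n) S)     = subst (Cyclic 0) (sym (dropZeros-rotation₁ S)) []
Cyclic-dropZeros {suc n}     (run {zero}  _     S) = subst (Cyclic (suc n)) (sym (dropZeros-rotation n 0 S)) (run z<s _)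
Cyclic-dropZeros {suc n}     (run {suc a} a<n+2 S) = subst (Cyclic (suc n)) (sym (dropZeros-rotation n (suc a) S)) (run (≤-pred a<n+2) _)

-- Binomial bounds

[k+1]*[n+1]C[k+1]≡[n+1]*nCk : ∀ n k → suc k * (suc n C suc k) ≡ suc n * (n C k)
[k+1]*[n+1]C[k+1]≡[n+1]*nCk zero    zero    = refl
[k+1]*[n+1]C[k+1]≡[n+1]*nCk zero    (suc k) = *-zeroʳ (suc (suc k))
[k+1]*[n+1]C[k+1]≡[n+1]*nCk (suc n) zero    = trans (*-identityˡ _) (trans (nC1≡n (suc (suc n))) (sym (*-identityʳ (suc (suc n)))))
[k+1]*[n+1]C[k+1]≡[n+1]*nCk (suc n) (suc k) = begin
  suc (suc k) * (suc (suc n) C suc (suc k)) ≡⟨ cong (suc (suc k) *_) (nCk+nC[k+1]≡[n+1]C[k+1] (suc n) (suc k)) ⟨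
  suc (suc k) * (X + Y)                     ≡⟨ distrib₁ k X Y ⟩
  suc k * X + X + suc (suc k) * Y           ≡⟨ cong₂ (λ u v → u + X + v) ([k+1]*[n+1]C[k+1]≡[n+1]*nCk n k)
                                                                             ([k+1]*[n+1]C[k+1]≡[n+1]*nCk n (suc k)) ⟩
  suc n * (n C k) + X + suc n * (n C suc k) ≡⟨ distrib₂ n (n C k) X (n C suc k) ⟩
  suc n * (n C k + n C suc k) + X           ≡⟨ cong (λ u → suc n * u + X) (nCk+nC[k+1]≡[n+1]C[k+1] n k) ⟩
  suc n * X + X                             ≡⟨ distrib₃ n X ⟩
  suc (suc n) * X                           ∎
  where
  open ≡-Reasoning
  X = suc n C suc k
  Y = suc n C suc (suc k)
  distrib₁ : ∀ k x y → suc (suc k) * (x + y) ≡ suc k * x + x + suc (suc k) * y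
  distrib₁ = solve-∀
  distrib₂ : ∀ n a x b → suc n * a + x + suc n * b ≡ suc n * (a + b) + x
  distrib₂ = solve-∀
  distrib₃ : ∀ n x → suc n * x + x ≡ suc (suc n) * x
  distrib₃ = solve-∀

nCk>0⇒k≤n : ∀ {n k} → 0 < n C k → k ≤ n
nCk>0⇒k≤n {n} {k} 0<nCk with k ≤? n
... | yes k≤n = k≤n
... | no  k≰n = contradiction (k>n⇒nCk≡0 (≰⇒> k≰n)) (≢-nonZero⁻¹ _ {{>-nonZero 0<nCk}})

*-cancelˡ-≤-slack : ∀ n {x y} → suc n * x ≤ suc n * y + n → x ≤ y
*-cancelˡ-≤-slack n {x} {y} le = ≤-pred (*-cancelˡ-< (suc n) x (suc y) (≤-trans (s≤s le) (≤-reflexive (identity n y))))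
  where
  identity : ∀ n y → suc (suc n * y + n) ≡ suc n * suc y
  identity = solve-∀

*-rearrangement : ∀ {r N d B} → r ≤ N → d ≤ B → N * d + r * B ≤ N * B + r * d
*-rearrangement {r} {N} {d} {B} r≤N d≤B =
  subst₂ (λ N B → N * d + r * B ≤ N * B + r * d) (m+[n∸m]≡n r≤N) (m+[n∸m]≡n d≤B)
    (≤-trans (m≤m+n _ ((N ∸ r) * (B ∸ d))) (≤-reflexive (identity r (N ∸ r) d (B ∸ d))))
  where
  identity : ∀ r e d f → (r + e) * d + r * (d + f) + e * f ≡ (r + e) * (d + f) + r * d
  identity = solve-∀

link-deletion-bounds : ∀ {n r d h} → suc r ≤ suc n → d ≤ suc n C suc r → NearQuotient n (d * suc r) h →
  h ≤ d × h ≤ n C r × d ∸ h ≤ n C suc r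
link-deletion-bounds {n} {r} {d} {h} R≤N d≤B (Nh≤dR+n , dR≤Nh+n) = h≤d , h≤link , m≤n+o⇒m∸n≤o d h d≤h+deletion
  where
  open ≤-Reasoning
  N = suc n
  R = suc r
  B = N C R
  pascal : n C r + n C R ≡ B
  pascal = nCk+nC[k+1]≡[n+1]C[k+1] n r
  h≤d : h ≤ d
  h≤d = *-cancelˡ-≤-slack n (begin
    N * h      ≤⟨ Nh≤dR+n ⟩
    d * R + n  ≤⟨ +-monoˡ-≤ n (*-monoʳ-≤ d R≤N) ⟩
    d * N + n  ≡⟨ cong (_+ n) (*-comm d N) ⟩
    N * d + n  ∎)
  h≤link : h ≤ n C r
  h≤link = *-cancelˡ-≤-slack n (begin
    N * h            ≤⟨ Nh≤dR+n ⟩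
    d * R + n        ≤⟨ +-monoˡ-≤ n (*-monoˡ-≤ R d≤B) ⟩
    B * R + n        ≡⟨ cong (_+ n) (trans (*-comm B R) ([k+1]*[n+1]C[k+1]≡[n+1]*nCk n r)) ⟩
    N * (n C r) + n  ∎)
  NB≡RB+Nb : N * B ≡ R * B + N * (n C R)
  NB≡RB+Nb = begin-equality
    N * B                         ≡⟨ cong (N *_) pascal ⟨
    N * (n C r + n C R)           ≡⟨ *-distribˡ-+ N (n C r) (n C R) ⟩
    N * (n C r) + N * (n C R)     ≡⟨ cong (_+ N * (n C R)) ([k+1]*[n+1]C[k+1]≡[n+1]*nCk n r) ⟨
    R * B + N * (n C R)           ∎
  Nd≤Nb+Rd : N * d ≤ N * (n C R) + R * d
  Nd≤Nb+Rd = +-cancelˡ-≤ (R * B) _ _ (begin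
    R * B + N * d                 ≡⟨ +-comm (R * B) (N * d) ⟩
    N * d + R * B                 ≤⟨ *-rearrangement R≤N d≤B ⟩
    N * B + R * d                 ≡⟨ cong (_+ R * d) NB≡RB+Nb ⟩
    R * B + N * (n C R) + R * d   ≡⟨ +-assoc (R * B) _ _ ⟩
    R * B + (N * (n C R) + R * d) ∎)
  d≤h+deletion : d ≤ h + n C R
  d≤h+deletion = *-cancelˡ-≤-slack n (begin
    N * d                         ≤⟨ Nd≤Nb+Rd ⟩
    N * (n C R) + R * d           ≡⟨ cong (N * (n C R) +_) (*-comm R d) ⟩
    N * (n C R) + d * R           ≤⟨ +-monoʳ-≤ (N * (n C R)) dR≤Nh+n ⟩
    N * (n C R) + (N * h + n)     ≡⟨ +-assoc (N * (n C R)) (N * h) n ⟨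
    N * (n C R) + N * h + n       ≡⟨ cong (_+ n) (trans (+-comm _ (N * h)) (sym (*-distribˡ-+ N h (n C R)))) ⟩
    N * (h + n C R) + n           ∎)

link-deletion-lengths : ∀ {ℓ h d r} → h ≤ d → ℓ + h ≡ d * suc r → ℓ ≡ h * r + (d ∸ h) * suc r
link-deletion-lengths {ℓ} {h} {d} {r} h≤d ℓ+h≡dR = +-cancelʳ-≡ h ℓ _ (begin
  ℓ + h                       ≡⟨ ℓ+h≡dR ⟩
  d * suc r                   ≡⟨ cong (_* suc r) (m∸n+n≡m h≤d) ⟨
  (d ∸ h + h) * suc r         ≡⟨ identity (d ∸ h) h r ⟩
  h * r + (d ∸ h) * suc r + h ∎)
  where
  open ≡-Reasoning
  identity : ∀ e h r → (e + h) * suc r ≡ h * r + e * suc r + h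
  identity = solve-∀

-- Hypergraphs

module _ {m n : ℕ} (f : Subset m → Subset n) where

  degree-map : ∀ {v w} → (∀ e → does (v ∈? f e) ≡ does (w ∈? e)) → ∀ F → degree (map f F) v ≡ degree F w
  degree-map         agree []      = refl
  degree-map {v} {w} agree (e ∷ F) with does (v ∈? f e) | does (w ∈? e) | agree e
  ... | true  | true  | _ = cong suc (degree-map agree F)
  ... | false | false | _ = degree-map agree F

  degree-map-∉ : ∀ {v} → (∀ e → does (v ∈? f e) ≡ false) → ∀ F → degree (map f F) v ≡ 0
  degree-map-∉     absent []      = refl
  degree-map-∉ {v} absent (e ∷ F) with does (v ∈? f e) | absent e
  ... | false | _ = degree-map-∉ absent F

  degree-map-∈ : ∀ {v} → (∀ e → does (v ∈? f e) ≡ true) → ∀ F → degree (map f F) v ≡ length F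
  degree-map-∈     present []      = refl
  degree-map-∈ {v} present (e ∷ F) with does (v ∈? f e) | present e
  ... | true | _ = cong suc (degree-map-∈ present F)

degree-++ : ∀ {n} (F G : Hypergraph n) v → degree (F ++ G) v ≡ degree F v + degree G v
degree-++ F G v = trans (cong length (filter-++ (v ∈?_) F G)) (length-++ (filter (v ∈?_) F))

-- L is the link and D the deletion of the new vertex 0.
extend : ∀ {n} → Hypergraph n → Hypergraph n → Hypergraph (suc n)
extend L D = map (inside ∷_) L ++ map (outside ∷_) D

degree-extend-zero : ∀ {n} (L D : Hypergraph n) → degree (extend L D) zero ≡ length L
degree-extend-zero L D = begin
  degree (extend L D) zero                                              ≡⟨ degree-++ (map (inside ∷_) L) _ zero ⟩
  degree (map (inside ∷_) L) zero + degree (map (outside ∷_) D) zero    ≡⟨ cong₂ _+_ (degree-map-∈ (inside ∷_) (λ _ → refl) L)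
                                                                                          (degree-map-∉ (outside ∷_) (λ _ → refl) D) ⟩
  length L + 0                                                          ≡⟨ +-identityʳ (length L) ⟩
  length L                                                              ∎
  where open ≡-Reasoning

degree-extend-suc : ∀ {n} (L D : Hypergraph n) v → degree (extend L D) (suc v) ≡ degree L v + degree D v
degree-extend-suc L D v = trans (degree-++ (map (inside ∷_) L) _ (suc v))
  (cong₂ _+_ (degree-map (inside ∷_) (λ _ → refl) L) (degree-map (outside ∷_) (λ _ → refl) D))

length-extend : ∀ {n} (L D : Hypergraph n) → length (extend L D) ≡ length L + length D
length-extend L D = trans (length-++ (map (inside ∷_) L)) (cong₂ _+_ (length-map _ L) (length-map _ D))

All-extend : ∀ {n} {P : Pred (Subset (suc n)) 0ℓ} {L D : Hypergraph n} →
  All (P ∘ (inside ∷_)) L → All (P ∘ (outside ∷_)) D → All P (extend L D)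
All-extend PL PD = All.++⁺ (All.map⁺ PL) (All.map⁺ PD)

Unique-extend : ∀ {n} {L D : Hypergraph n} → Unique L → Unique D → Unique (extend L D)
Unique-extend uL uD = Unique.++⁺ (Unique.map⁺ ∷-injectiveʳ uL) (Unique.map⁺ ∷-injectiveʳ uD) disjoint
  where
  disjoint : ∀ {e} → ¬ (e ∈ₗ map (inside ∷_) _ × e ∈ₗ map (outside ∷_) _)
  disjoint (e∈L , e∈D) with ∈-map⁻ (inside ∷_) e∈L | ∈-map⁻ (outside ∷_) e∈D
  ... | _ , _ , refl | _ , _ , ()

SimpleUniform-extend : ∀ {n r} {L D : Hypergraph n} → SimpleUniform r L → SimpleUniform (suc r) D → SimpleUniform (suc r) (extend L D)
SimpleUniform-extend (uL , ∣L∣) (uD , ∣D∣) = Unique-extend uL uD , All-extend (All.map (cong suc) ∣L∣) ∣D∣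

-- Realising cyclic runs and the round-robin construction

record Realization (n r d : ℕ) (ws : List ℕ) : Set where
  field
    edges         : Hypergraph n
    simpleUniform : SimpleUniform r edges
    size          : length edges ≡ d
    realizes      : Realizes edges (λ v → count (toℕ v) ws)

realize : ∀ n r d {ws} → Cyclic n ws → length ws ≡ d * r → d ≤ n C r → Realization n r d ws
realize n       r       zero          {[]}    _  _  _        = record
  { edges = [] ; simpleUniform = [] , [] ; size = refl ; realizes = λ _ → refl }
realize n       zero    (suc zero)    {[]}    _  _  _        = record
  { edges = ⊥ ∷ [] ; simpleUniform = [] ∷ [] , ∣⊥∣≡0 n ∷ [] ; size = refl
  ; realizes = λ v → cong length (filter-reject (v ∈?_) ∉⊥) }
realize n       r       zero          {_ ∷ _} _  () _
realize n       zero    (suc zero)    {_ ∷ _} _  () _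
realize n       zero    (suc (suc _))         _  _  (s≤s ())
realize zero    (suc r) (suc _)               _  _  ()
realize (suc n) (suc r) (suc _)               [] () _
realize (suc n) (suc r) d@(suc _) {ws} cyclic@(run a<N S) len d≤B = record
  { edges         = extend L.edges D.edges
  ; simpleUniform = SimpleUniform-extend L.simpleUniform D.simpleUniform
  ; size          = trans (length-extend L.edges D.edges) (trans (cong₂ _+_ L.size D.size) (m+[n∸m]≡n h≤d))
  ; realizes      = degrees
  }
  where
  h = count 0 ws
  rest = dropZeros ws
  split = h * r
  bounds = link-deletion-bounds (nCk>0⇒k≤n (≤-trans z<s d≤B)) d≤B
    (subst (λ S → NearQuotient n S h) (trans (sym (length-rotation (suc n) _ S)) len)
      (count-rotation-nearQuotient S a<N z<s))
  h≤d = proj₁ bounds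
  length-rest : length rest ≡ split + (d ∸ h) * suc r
  length-rest = link-deletion-lengths h≤d (trans (length-dropZeros ws) len)
  module L = Realization (realize n r h (Cyclic-take split (Cyclic-dropZeros cyclic))
    (length-take-+ split rest length-rest) (proj₁ (proj₂ bounds)))
  module D = Realization (realize n (suc r) (d ∸ h) (Cyclic-drop split (Cyclic-dropZeros cyclic))
    (length-drop-+ split rest length-rest) (proj₂ (proj₂ bounds)))
  degrees : Realizes (extend L.edges D.edges) (λ v → count (toℕ v) ws)
  degrees zero    = trans (degree-extend-zero L.edges D.edges) L.size
  degrees (suc v) = begin
    degree (extend L.edges D.edges) (suc v)                           ≡⟨ degree-extend-suc L.edges D.edges v ⟩
    degree L.edges v + degree D.edges v                               ≡⟨ cong₂ _+_ (L.realizes v) (D.realizes v) ⟩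
    count (toℕ v) (take split rest) + count (toℕ v) (drop split rest) ≡⟨ count-++ (toℕ v) (take split rest) _ ⟨
    count (toℕ v) (take split rest ++ drop split rest)                ≡⟨ cong (count (toℕ v)) (take++drop≡id split rest) ⟩
    count (toℕ v) rest                                                ≡⟨ count-dropZeros (toℕ v) ws ⟩
    count (suc (toℕ v)) ws                                            ∎
    where open ≡-Reasoning

pad : ∀ s {m} → Subset m → Subset (s + m)
pad s e = ⊥ ++ᵥ e

∣pad∣ : ∀ s {m} (e : Subset m) → ∣ pad s e ∣ ≡ ∣ e ∣
∣pad∣ zero    e = refl
∣pad∣ (suc s) e = ∣pad∣ s e

firstGroupCount-pad : ∀ s {m} (e : Subset m) → firstGroupCount s m (pad s e) ≡ 0
firstGroupCount-pad zero    e = refl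
firstGroupCount-pad (suc s) e = firstGroupCount-pad s e

∈?-pad-↑ˡ : ∀ {s m} (i : Fin s) (e : Subset m) → does ((i ↑ˡ m) ∈? pad s e) ≡ false
∈?-pad-↑ˡ zero    e = refl
∈?-pad-↑ˡ (suc i) e = ∈?-pad-↑ˡ i e

∈?-pad-↑ʳ : ∀ s {m} (j : Fin m) (e : Subset m) → does ((s ↑ʳ j) ∈? pad s e) ≡ does (j ∈? e)
∈?-pad-↑ʳ zero    j e = refl
∈?-pad-↑ʳ (suc s) j e = ∈?-pad-↑ʳ s j e

SimpleUniform-map-pad : ∀ s {m r} {F : Hypergraph m} → SimpleUniform r F → SimpleUniform r (map (pad s) F)
SimpleUniform-map-pad s (unique , uniform) =
  Unique.map⁺ (++-injectiveʳ ⊥ ⊥) unique , All.map⁺ (All.map (trans (∣pad∣ s _)) uniform)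

record CentredRealization (s m r d : ℕ) (ws : List ℕ) : Set where
  field
    edges         : Hypergraph (s + m)
    simpleUniform : SimpleUniform (suc r) edges
    oneCentre     : All (λ e → firstGroupCount s m e ≡ 1) edges
    centreDegree  : ∀ i → degree edges (i ↑ˡ m) ≡ d
    leafDegree    : ∀ j → degree edges (s ↑ʳ j) ≡ count (toℕ j) ws

realizeCentred : ∀ s {m} r d {a} → a < m → d ≤ m C r → CentredRealization s m r d (rotation m a (s * d * r))
realizeCentred zero    r d a<m d≤C = record
  { edges = [] ; simpleUniform = [] , [] ; oneCentre = [] ; centreDegree = λ () ; leafDegree = λ _ → refl }
realizeCentred (suc s) {m} r d {a} a<m d≤C = record
  { edges         = extend star H.edges
  ; simpleUniform = SimpleUniform-extend (SimpleUniform-map-pad s F.simpleUniform) H.simpleUniform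
  ; oneCentre     = All-extend (All.map⁺ (All.universal (λ e → cong suc (firstGroupCount-pad s e)) F.edges)) H.oneCentre
  ; centreDegree  = centreDegree
  ; leafDegree    = leafDegree
  }
  where
  own = rotation m a (d * r)
  others = rotation m (shift m a (d * r)) (s * d * r)
  module F = Realization (realize m r d (run a<m (d * r)) (length-rotation m a (d * r)) d≤C)
  module H = CentredRealization (realizeCentred s r d (shift-< (d * r) a<m) d≤C)
  star = map (pad s) F.edges
  centreDegree : ∀ i → degree (extend star H.edges) (i ↑ˡ m) ≡ d
  centreDegree zero    = trans (degree-extend-zero star H.edges) (trans (length-map _ F.edges) F.size)
  centreDegree (suc i) = trans (degree-extend-suc star H.edges (i ↑ˡ m))
    (cong₂ _+_ (degree-map-∉ (pad s) (∈?-pad-↑ˡ i) F.edges) (H.centreDegree i))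
  leafDegree : ∀ j → degree (extend star H.edges) (suc s ↑ʳ j) ≡ count (toℕ j) (rotation m a (suc s * d * r))
  leafDegree j = begin
    degree (extend star H.edges) (suc s ↑ʳ j)         ≡⟨ degree-extend-suc star H.edges (s ↑ʳ j) ⟩
    degree star (s ↑ʳ j) + degree H.edges (s ↑ʳ j)    ≡⟨ cong₂ _+_ (degree-map (pad s) (∈?-pad-↑ʳ s j) F.edges) (H.leafDegree j) ⟩
    degree F.edges j + count (toℕ j) others           ≡⟨ cong (_+ count (toℕ j) others) (F.realizes j) ⟩
    count (toℕ j) own + count (toℕ j) others          ≡⟨ count-++ (toℕ j) own others ⟨
    count (toℕ j) (own ++ others)                     ≡⟨ cong (count (toℕ j)) (rotation-+ m a (d * r) (s * d * r)) ⟨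
    count (toℕ j) (rotation m a (d * r + s * d * r))  ≡⟨ cong (count (toℕ j) ∘ rotation m a) (*-distribʳ-+ r d (s * d)) ⟨
    count (toℕ j) (rotation m a (suc s * d * r))      ∎
    where open ≡-Reasoning

[ρ+q*m]/m≡q : ∀ {ρ q m} .{{_ : NonZero m}} → ρ < m → (ρ + q * m) / m ≡ q
[ρ+q*m]/m≡q {ρ} {q} {m} ρ<m = begin
  (ρ + q * m) / m      ≡⟨ +-distrib-/-∣ʳ ρ (divides q refl) ⟩
  ρ / m + q * m / m    ≡⟨ cong₂ _+_ (m<n⇒m/n≡0 ρ<m) (m*n/n≡m q m) ⟩
  q                    ∎
  where open ≡-Reasoning

≤-*-ceilDiv : ∀ x m .{{_ : NonZero m}} → x ≤ m * ceilDiv x m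
≤-*-ceilDiv x m@(suc m-1) = +-cancelʳ-≤ m-1 x (m * c) (begin
  x + m-1                ≡⟨ m≡m%n+[m/n]*n (x + m-1) m ⟩
  (x + m-1) % m + c * m  ≤⟨ +-monoˡ-≤ (c * m) (≤-pred (m%n<n (x + m-1) m)) ⟩
  m-1 + c * m            ≡⟨ cong (m-1 +_) (*-comm c m) ⟩
  m-1 + m * c            ≡⟨ +-comm m-1 (m * c) ⟩
  m * c + m-1            ∎)
  where
  open ≤-Reasoning
  c = ceilDiv x m

*-ceilDiv-≤ : ∀ x m .{{_ : NonZero m}} → m * ceilDiv x m ≤ x + (m ∸ 1)
*-ceilDiv-≤ x m = subst (_≤ x + (m ∸ 1)) (*-comm (ceilDiv x m) m) (m/n*n≤m (x + (m ∸ 1)) m)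

count-interval+count-rotation : ∀ {m k x c j} → k < m → j < m → k + x ≡ m * c →
  count j (interval 0 k) + count j (rotation m k x) ≡ c
count-interval+count-rotation {m} {k} {x} {c} {j} k<m j<m k+x≡mc = begin
  count j (interval 0 k) + count j (rotation m k x)                 ≡⟨ cong₂ (λ u b → count j u + count j (rotation m b x))
                                                                                (rotation-interval k (<⇒≤ k<m)) (shift-interval k k<m) ⟨
  count j (rotation m 0 k) + count j (rotation m (shift m 0 k) x)   ≡⟨ count-++ j (rotation m 0 k) _ ⟨
  count j (rotation m 0 k ++ rotation m (shift m 0 k) x)            ≡⟨ cong (count j) (rotation-+ m 0 k x) ⟨
  count j (rotation m 0 (k + x))                                    ≡⟨ cong (count j ∘ rotation m 0) k+x≡cm+0 ⟩
  count j (rotation m 0 (c * m + 0))                                ≡⟨ count-rotation-periods c 0 (≤-trans z<s k<m) j<m ⟩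
  c + 0                                                             ≡⟨ +-identityʳ c ⟩
  c                                                                 ∎
  where
  open ≡-Reasoning
  k+x≡cm+0 : k + x ≡ c * m + 0
  k+x≡cm+0 = trans k+x≡mc (trans (*-comm m c) (sym (+-identityʳ (c * m))))

count-rotation-from-offset : ∀ {m k x c j} .{{_ : NonZero m}} → k < m → j < m → k + x ≡ m * c →
  count j (rotation m k x) ≡ (if j <ᵇ k then x / m else c)
count-rotation-from-offset {m} {k} {x} {c} {j} k<m j<m k+x≡mc with j <ᵇ k in j<ᵇk
... | false = trans (cong (_+ count j (rotation m k x)) (sym (count-interval-above k k≤j)))
                    (count-interval+count-rotation k<m j<m k+x≡mc)
  where
  k≤j : k ≤ j
  k≤j = ≮⇒≥ (λ j<k → subst T j<ᵇk (<⇒<ᵇ j<k))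
... | true  = sym (trans (cong (_/ m) x≡[m-k]+e*m) ([ρ+q*m]/m≡q m-k<m))
  where
  open ≡-Reasoning
  e = count j (rotation m k x)
  j<k : j < k
  j<k = <ᵇ⇒< j k (Equivalence.from T-≡ j<ᵇk)
  1+e≡c : suc e ≡ c
  1+e≡c = trans (cong (_+ e) (sym (count-interval-inside k z≤n j<k))) (count-interval+count-rotation k<m j<m k+x≡mc)
  m-k<m : m ∸ k < m
  m-k<m = ∸-monoʳ-< {o = 0} (≤-trans z<s j<k) (<⇒≤ k<m)
  x≡[m-k]+e*m : x ≡ m ∸ k + e * m
  x≡[m-k]+e*m = +-cancelˡ-≡ k x _ (begin
    k + x                 ≡⟨ k+x≡mc ⟩
    m * c                 ≡⟨ cong (m *_) 1+e≡c ⟨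
    m * suc e             ≡⟨ *-suc m e ⟩
    m + m * e             ≡⟨ cong₂ _+_ (m+[n∸m]≡n (<⇒≤ k<m)) (*-comm e m) ⟨
    k + (m ∸ k) + e * m   ≡⟨ +-assoc k (m ∸ k) (e * m) ⟩
    k + (m ∸ k + e * m)   ∎)

lemma2 : (t s d m : ℕ) → t ≥ 3 → s > 0 → d > 0 → (m>0 : m > 0) →
    m C (t ∸ 1) ≥ d →
    Σ (Hypergraph (s + m)) (λ H →
      SimpleUniform t H ×
      Realizes H (degSeq t s d m {{>-nonZero m>0}}) ×
      All (λ e → firstGroupCount s m e ≡ 1) H)
lemma2 (suc t) s d (suc m) _ _ _ _ d≤C = H.edges , H.simpleUniform , degrees , H.oneCentre
  where
  x = s * d * t
  k = suc m * ceilDiv x (suc m) ∸ x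
  k<m : k < suc m
  k<m = s≤s (m≤n+o⇒m∸n≤o _ x (*-ceilDiv-≤ x (suc m)))
  module H = CentredRealization (realizeCentred s t d k<m d≤C)
  degrees : Realizes H.edges (degSeq (suc t) s d (suc m))
  degrees v with splitAt s v in eq
  ... | inj₁ i = subst (λ w → degree H.edges w ≡ d) (splitAt⁻¹-↑ˡ eq) (H.centreDegree i)
  ... | inj₂ j = subst (λ w → degree H.edges w ≡ _) (splitAt⁻¹-↑ʳ eq)
    (trans (H.leafDegree j) (count-rotation-from-offset k<m (toℕ<n j) (m∸n+n≡m (≤-*-ceilDiv x (suc m)))))
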